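{- $\kappa^s(Q_4;K_{1,4})\ge 2$.
   Context: The $n$-dimensional hypercube $Q_n$ has as vertices all binary strings of length $n$, two strings being adjacent iff they differ in exactly one position. $K_{1,r}$ denotes the star with $r$ leaves. For a graph $G$ and a set $F$ of subgraphs of $G$, $G-F$ denotes the graph obtained from $G$ by deleting all vertices of all members of $F$. For a connected graph $T$, $\kappa^s(G;T)$ is the minimum cardinality of a set $F$ of subgraphs of $G$, each isomorphic to a connected subgraph of $T$, such that $G-F$ is disconnected. -}

module Defs where

open import Data.Nat using (ℕ; zero; suc; _+_; _≤_)
open import Data.Bool using (Bool; true; false; T; not; _∧_)
open import Data.Vec using (Vec; []; _∷_)
open import Data.Fin using (Fin; zero; suc)
open import Data.List using (List; length)
open import Data.List.Relation.Unary.All using (All)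
open import Data.List.Relation.Unary.Any using (Any)
open import Data.Product using (Σ; ∃; _×_; proj₁)
open import Data.Unit using (⊤)
open import Data.Empty using (⊥)
open import Function using (_↔_)
open import Function.Bundles using (Inverse)
open import Relation.Nullary using (¬_)
open import Relation.Binary.PropositionalEquality using (_≡_)
open import Relation.Binary.Construct.Closure.ReflexiveTransitive using (Star)

record Graph : Set₁ where
  field
    V   : Set
    Adj : V → V → Set
open Graph public

Connected : Graph → Set
Connected G = (Σ (V G) (λ _ → ⊤)) × (∀ u v → Star (Adj G) u v)

hamming : ∀ {n} → Vec Bool n → Vec Bool n → ℕ
hamming [] [] = 0
hamming (true ∷ xs) (true ∷ ys) = hamming xs ys
hamming (false ∷ xs) (false ∷ ys) = hamming xs ys
hamming (true ∷ xs) (false ∷ ys) = suc (hamming xs ys)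
hamming (false ∷ xs) (true ∷ ys) = suc (hamming xs ys)

Q : ℕ → Graph
Q n = record { V = Vec Bool n ; Adj = λ u v → hamming u v ≡ 1 }

-- The star K_{1,r}: vertex 0 is the centre, vertices 1..r are the leaves.
starAdj : ∀ {r} → Fin (suc r) → Fin (suc r) → Set
starAdj zero    zero    = ⊥
starAdj zero    (suc _) = ⊤
starAdj (suc _) zero    = ⊤
starAdj (suc _) (suc _) = ⊥

K1 : ℕ → Graph
K1 r = record { V = Fin (suc r) ; Adj = starAdj }

record Subgraph (G : Graph) : Set where
  field
    InV       : V G → Bool
    InE       : V G → V G → Bool
    edge-adj  : ∀ {u v} → T (InE u v) → Adj G u v
    edge-ends : ∀ {u v} → T (InE u v) → T (InV u) × T (InV v)
    edge-sym  : ∀ {u v} → T (InE u v) → T (InE v u)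
open Subgraph public

SV : ∀ {G} → Subgraph G → Set
SV {G} H = Σ (V G) (λ v → T (InV H v))

asGraph : ∀ {G} → Subgraph G → Graph
asGraph H = record { V = SV H ; Adj = λ x y → T (InE H (proj₁ x) (proj₁ y)) }

Iso : ∀ {G T′} → Subgraph G → Subgraph T′ → Set
Iso H H′ = Σ (SV H ↔ SV H′) λ f →
  ∀ x y → InE H (proj₁ x) (proj₁ y) ≡ InE H′ (proj₁ (Inverse.to f x)) (proj₁ (Inverse.to f y))

Admissible : (G T′ : Graph) → Subgraph G → Set
Admissible G T′ H = ∃ λ (H′ : Subgraph T′) → Connected (asGraph H′) × Iso H H′

_─_ : (G : Graph) → List (Subgraph G) → Graph
G ─ F = record
  { V   = Σ (V G) (λ v → ¬ Any (λ H → T (InV H v)) F)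
  ; Adj = λ x y → Adj G (proj₁ x) (proj₁ y) }

KappaSAtLeast : Graph → Graph → ℕ → Set
KappaSAtLeast G T′ k =
  (F : List (Subgraph G)) → All (Admissible G T′) F → ¬ Connected (G ─ F) → k ≤ length F

-- A connected subgraph of a star has a vertex c adjacent to all its other vertices, so deleting it
-- from Q_n removes c and possibly some neighbours of c, but no vertex at distance ≥ 2 from c.
-- Every surviving vertex x ≠ c has a walk to the antipode of c along which the distance from c
-- strictly increases; after the first step the walk is at distance ≥ 2, hence stays among the
-- survivors. So Q_n minus one admissible subgraph (and a fortiori Q_n itself) is connected.
module Submission where

open import Defs
open import Level using (0ℓ)
open import Data.Nat using (ℕ; zero; suc; _≤_; z≤n; s≤s)
open import Data.Nat.Properties using (≤-refl; ≤-trans; ≤-reflexive; ≤⇒≯; m≤n⇒m≤1+n)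
open import Data.Bool using (Bool; true; false; T; not)
open import Data.Bool.Properties using (T-irrelevant)
open import Data.Vec using (Vec; []; _∷_; map; replicate)
open import Data.Fin using (zero; suc; _≟_)
open import Data.List using (List; []; _∷_)
open import Data.List.Relation.Unary.All using ([]; _∷_)
open import Data.List.Relation.Unary.Any using (Any; here)
open import Data.Product using (∃; _×_; _,_; proj₁; proj₂)
open import Data.Sum using (_⊎_; inj₁; inj₂)
open import Data.Unit using (tt)
open import Data.Empty using (⊥-elim)
open import Function.Base using (_∘_)
open import Function.Bundles using (Inverse)
open import Relation.Nullary using (¬_; yes; no)
open import Relation.Nullary.Decidable using (T?)
open import Relation.Binary using (Rel; Symmetric)
open import Relation.Binary.PropositionalEquality using (_≡_; _≢_; refl; sym; trans; cong; subst)
open import Relation.Binary.Construct.Closure.ReflexiveTransitive using (Star; ε; _◅_; _◅◅_; gmap; reverse)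

hamming-refl : ∀ {n} (x : Vec Bool n) → hamming x x ≡ 0
hamming-refl []          = refl
hamming-refl (true ∷ x)  = hamming-refl x
hamming-refl (false ∷ x) = hamming-refl x

hamming-sym : ∀ {n} (x y : Vec Bool n) → hamming x y ≡ hamming y x
hamming-sym []          []          = refl
hamming-sym (true ∷ x)  (true ∷ y)  = hamming-sym x y
hamming-sym (false ∷ x) (false ∷ y) = hamming-sym x y
hamming-sym (true ∷ x)  (false ∷ y) = cong suc (hamming-sym x y)
hamming-sym (false ∷ x) (true ∷ y)  = cong suc (hamming-sym x y)

hamming≡0⇒≡ : ∀ {n} (x y : Vec Bool n) → hamming x y ≡ 0 → x ≡ y
hamming≡0⇒≡ []          []          _  = refl
hamming≡0⇒≡ (true ∷ x)  (true ∷ y)  eq = cong (true ∷_) (hamming≡0⇒≡ x y eq)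
hamming≡0⇒≡ (false ∷ x) (false ∷ y) eq = cong (false ∷_) (hamming≡0⇒≡ x y eq)
hamming≡0⇒≡ (true ∷ x)  (false ∷ y) ()
hamming≡0⇒≡ (false ∷ x) (true ∷ y)  ()

hamming-map-not : ∀ {n} (x : Vec Bool n) → hamming x (map not x) ≡ n
hamming-map-not []          = refl
hamming-map-not (true ∷ x)  = cong suc (hamming-map-not x)
hamming-map-not (false ∷ x) = cong suc (hamming-map-not x)

Ascending : ∀ {n} → Vec Bool n → Rel (Vec Bool n) 0ℓ
Ascending c x y = hamming x y ≡ 1 × suc (hamming c x) ≤ hamming c y

ascending-∷ : ∀ {n} a b {c x y : Vec Bool n} → Ascending c x y → Ascending (b ∷ c) (a ∷ x) (a ∷ y)
ascending-∷ true  true  (adj , further) = adj , further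
ascending-∷ false false (adj , further) = adj , further
ascending-∷ true  false (adj , further) = adj , s≤s further
ascending-∷ false true  (adj , further) = adj , s≤s further

ascending-walk : ∀ {n} (c u : Vec Bool n) → Star (Ascending c) u (map not c)
ascending-walk []      []      = ε
ascending-walk (b ∷ c) (a ∷ u) = gmap (a ∷_) (ascending-∷ a b) (ascending-walk c u) ◅◅ fix-head b a
  where
  flip-step : ∀ b → Ascending (b ∷ c) (b ∷ map not c) (not b ∷ map not c)
  flip-step true  = cong suc (hamming-refl (map not c)) , ≤-refl
  flip-step false = cong suc (hamming-refl (map not c)) , ≤-refl

  fix-head : ∀ b a → Star (Ascending (b ∷ c)) (a ∷ map not c) (not b ∷ map not c)
  fix-head true  false = ε
  fix-head false true  = ε
  fix-head true  true  = flip-step true ◅ ε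
  fix-head false false = flip-step false ◅ ε

Survives : ∀ {G} → List (Subgraph G) → V G → Set
Survives F v = ¬ Any (λ H → T (InV H v)) F

-- Survival proofs are functions, so without function extensionality (x , p) and (x , q) may
-- differ; a detour through a surviving neighbour connects them.
detour : ∀ {G F x y} → Adj G x y → Adj G y x → Survives F y →
         (p q : Survives F x) → Star (Adj (G ─ F)) (x , p) (x , q)
detour xy yx py p q = _◅_ {j = _ , py} xy (yx ◅ ε)

connected-from-hub : ∀ {G} → Symmetric (Adj G) → (h : V G) → (∀ v → Star (Adj G) v h) → Connected G
connected-from-hub adj-sym h reach = (h , tt) , λ u v → reach u ◅◅ reverse adj-sym (reach v)

Q─-adj-sym : ∀ {n} (F : List (Subgraph (Q n))) → Symmetric (Adj (Q n ─ F))
Q─-adj-sym F {x} {y} adj = trans (hamming-sym (proj₁ y) (proj₁ x)) adj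

module _ {n} {F : List (Subgraph (Q n))} {k : ℕ} (c : Vec Bool n)
         (far-survives : ∀ z → k ≤ hamming c z → Survives F z) where

  climb : ∀ {x y} → Star (Ascending c) x y → (px : Survives F x) → k ≤ suc (hamming c x) →
          ∃ λ py → Star (Adj (Q n ─ F)) (x , px) (y , py)
  climb ε                                 px _  = px , ε
  climb (_◅_ {j = x′} (adj , further) rest) px kx with climb rest (far-survives x′ kx′) (m≤n⇒m≤1+n kx′)
    where kx′ = ≤-trans kx further
  ... | py , walk = py , adj ◅ walk

Q─ball-connected : ∀ {m} (F : List (Subgraph (Q (suc m)))) (c : Vec Bool (suc m)) (k : ℕ) → k ≤ m →
                   (∀ z → k ≤ hamming c z → Survives F z) →
                   (∀ z → Survives F z → k ≤ suc (hamming c z)) →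
                   Connected (Q (suc m) ─ F)
Q─ball-connected {m} F (b ∷ c) k k≤m far-survives near =
  connected-from-hub (λ {x} {y} → Q─-adj-sym F {x} {y}) (antipode , antipode-survives) reach
  where
  antipode  = not b ∷ map not c
  neighbour = b ∷ map not c

  distance-neighbour : ∀ b → hamming (b ∷ c) (b ∷ map not c) ≡ m
  distance-neighbour true  = hamming-map-not c
  distance-neighbour false = hamming-map-not c

  neighbour-survives : Survives F neighbour
  neighbour-survives = far-survives neighbour (≤-trans k≤m (≤-reflexive (sym (distance-neighbour b))))

  antipode-survives : Survives F antipode
  antipode-survives = far-survives antipode
    (≤-trans (m≤n⇒m≤1+n k≤m) (≤-reflexive (sym (hamming-map-not (b ∷ c)))))

  flip-adjacent : ∀ b → hamming (b ∷ map not c) (not b ∷ map not c) ≡ 1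
  flip-adjacent true  = cong suc (hamming-refl (map not c))
  flip-adjacent false = cong suc (hamming-refl (map not c))

  reach : ∀ v → Star (Adj (Q (suc m) ─ F)) v (antipode , antipode-survives)
  reach (v , pv) with climb (b ∷ c) far-survives (ascending-walk (b ∷ c) v) pv (near v pv)
  ... | p , walk = walk ◅◅ detour {Q (suc m)} (trans (hamming-sym antipode neighbour) (flip-adjacent b))
                                              (flip-adjacent b) neighbour-survives p antipode-survives

Q-connected : ∀ m → Connected (Q (suc m) ─ [])
Q-connected m = Q─ball-connected [] (replicate (suc m) true) 0 z≤n (λ _ _ ()) (λ _ _ → z≤n)

Dominates : ∀ {G} (H : Subgraph G) → SV H → Set
Dominates H c = ∀ x → x ≡ c ⊎ T (InE H (proj₁ x) (proj₁ c))

SV-≡ : ∀ {G} {H : Subgraph G} {x y : SV H} → proj₁ x ≡ proj₁ y → x ≡ y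
SV-≡ {x = _ , p} {y = _ , q} refl = cong (_ ,_) (T-irrelevant p q)

leaf-edge-to-centre : ∀ {r} (H : Subgraph (K1 r)) {i p y} →
                      Star (Adj (asGraph H)) (suc i , p) y → suc i ≢ proj₁ y → T (InE H (suc i) zero)
leaf-edge-to-centre H ε                            leaf≢y = ⊥-elim (leaf≢y refl)
leaf-edge-to-centre H (_◅_ {j = zero  , _} edge _) _      = edge
leaf-edge-to-centre H (_◅_ {j = suc _ , _} edge _) _      = ⊥-elim (edge-adj H edge)

connected-star-subgraph-dominated : ∀ {r} (H : Subgraph (K1 r)) → Connected (asGraph H) → ∃ (Dominates H)
connected-star-subgraph-dominated H ((y₀ , _) , conn) with T? (InV H zero) | y₀
... | yes centre∈H | _           = (zero , centre∈H) , dominates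
  where
  dominates : Dominates H (zero , centre∈H)
  dominates (zero  , _) = inj₁ (SV-≡ {H = H} refl)
  dominates (suc i , p) = inj₂ (leaf-edge-to-centre H (conn (suc i , p) (zero , centre∈H)) (λ ()))
... | no centre∉H | zero  , p    = ⊥-elim (centre∉H p)
... | no centre∉H | suc i , p    = (suc i , p) , dominates
  where
  dominates : Dominates H (suc i , p)
  dominates (j , q) with j ≟ suc i
  ... | yes refl = inj₁ (SV-≡ {H = H} refl)
  ... | no j≢i   = ⊥-elim (centre∉H (proj₂ (edge-ends H
                     (leaf-edge-to-centre H (conn (suc i , p) (j , q)) (j≢i ∘ sym)))))

Iso-dominates : ∀ {G G′} {H : Subgraph G} {H′ : Subgraph G′} ((f , pres) : Iso H H′) →
                ∀ {h} → Dominates H′ h → Dominates H (Inverse.from f h)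
Iso-dominates {H = H} {H′ = H′} (f , pres) {h} dominates x with dominates (Inverse.to f x)
... | inj₁ x↦h = inj₁ (sym (Inverse.inverseʳ f (sym x↦h)))
... | inj₂ edge = inj₂ (subst T (sym edge-preserved) edge)
  where
  open Inverse f
  edge-preserved : InE H (proj₁ x) (proj₁ (from h)) ≡ InE H′ (proj₁ (to x)) (proj₁ h)
  edge-preserved = trans (pres x (from h)) (cong (λ y → InE H′ (proj₁ (to x)) (proj₁ y)) (strictlyInverseˡ h))

admissible-star-dominated : ∀ {G r} (H : Subgraph G) → Admissible G (K1 r) H → ∃ (Dominates H)
admissible-star-dominated H (H′ , conn , iso) with connected-star-subgraph-dominated H′ conn
... | h , dominates = Inverse.from (proj₁ iso) h , Iso-dominates {H = H} {H′ = H′} iso dominates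

Q─dominated-connected : ∀ {m} (H : Subgraph (Q (suc m))) → 2 ≤ m → ∃ (Dominates H) →
                        Connected (Q (suc m) ─ (H ∷ []))
Q─dominated-connected H 2≤m ((c , c∈H) , dominates) =
  Q─ball-connected (H ∷ []) c 2 2≤m far-survives near
  where
  within-one : ∀ z → T (InV H z) → hamming c z ≤ 1
  within-one z z∈H with dominates (z , z∈H)
  ... | inj₁ refl = ≤-trans (≤-reflexive (hamming-refl c)) z≤n
  ... | inj₂ edge = ≤-reflexive (trans (hamming-sym c z) (edge-adj H edge))

  far-survives : ∀ z → 2 ≤ hamming c z → Survives (H ∷ []) z
  far-survives z 2≤d (here z∈H) = ≤⇒≯ (within-one z z∈H) 2≤d

  near : ∀ z → Survives (H ∷ []) z → 2 ≤ suc (hamming c z)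
  near z survives with hamming c z in d≡
  ... | zero  = ⊥-elim (survives (here (subst (λ w → T (InV H w)) (hamming≡0⇒≡ c z d≡) c∈H)))
  ... | suc _ = s≤s (s≤s z≤n)

lemma4p1 : KappaSAtLeast (Q 4) (K1 4) 2
lemma4p1 []          []           disconnected = ⊥-elim (disconnected (Q-connected 3))
lemma4p1 (H ∷ [])    (adm ∷ [])   disconnected =
  ⊥-elim (disconnected (Q─dominated-connected H (s≤s (s≤s z≤n)) (admissible-star-dominated H adm)))
lemma4p1 (_ ∷ _ ∷ _) _            _            = s≤s (s≤s z≤n)
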